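{- If $(a_1,a_2,a_3)$ is a $3$-flip sequence, then $a_3<2a_1^2$.
   Context: All graphs are finite and simple. For a strictly increasing sequence of positive integers $(a_1,a_2,a_3)$, a graph $G$ is an $(a_1,a_2,a_3)$-flip graph if there is an edge-colouring $f:E(G)\to\{1,2,3\}$ such that every vertex is incident with exactly $a_j$ edges of colour $j$ for $j=1,2,3$, and for every vertex $v$, $e_3[v]<e_2[v]<e_1[v]$, where $e_j[v]$ is the number of colour-$j$ edges with both endpoints in $N[v]=N(v)\cup\{v\}$. The sequence is a $3$-flip sequence if such a graph exists. -}

module Defs where

open import Data.Nat using (ℕ; zero; suc; _+_; _<_; _<ᵇ_)
open import Data.Bool using (Bool; true; false; if_then_else_; _∧_; _∨_)
open import Data.Fin using (Fin; toℕ)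
open import Data.Fin.Properties using (_≟_)
open import Data.Product using (Σ; ∃; _×_; _,_)
open import Relation.Nullary.Decidable using (⌊_⌋)
open import Relation.Binary.PropositionalEquality using (_≡_)

count : ∀ {n} → (Fin n → Bool) → ℕ
count {zero}  p = 0
count {suc n} p = (if p Fin.zero then 1 else 0) + count (λ i → p (Fin.suc i))

sumF : ∀ {n} → (Fin n → ℕ) → ℕ
sumF {zero}  f = 0
sumF {suc n} f = f Fin.zero + sumF (λ i → f (Fin.suc i))

record Graph (n : ℕ) : Set where
  field
    adj   : Fin n → Fin n → Bool
    sym   : ∀ x y → adj x y ≡ adj y x
    irrefl : ∀ x → adj x x ≡ false

open Graph public

-- an edge colouring with colours Fin 3 (colour 1,2,3 ↔ Fin.zero, 1, 2);
-- given as a symmetric function on pairs, only its values on edges matter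
record Colouring {n : ℕ} (G : Graph n) : Set where
  field
    col    : Fin n → Fin n → Fin 3
    colSym : ∀ x y → col x y ≡ col y x

open Colouring public

module _ {n : ℕ} {G : Graph n} (c : Colouring G) where

  isCol : Fin 3 → Fin n → Fin n → Bool
  isCol j x y = adj G x y ∧ ⌊ col c x y ≟ j ⌋

  degCol : Fin 3 → Fin n → ℕ
  degCol j v = count (λ u → isCol j v u)

  inClosedNbhd : Fin n → Fin n → Bool
  inClosedNbhd v x = ⌊ x ≟ v ⌋ ∨ adj G v x

  -- e_j[v]: number of colour-j edges with both endpoints in N[v]
  -- (each edge {x,y} counted once, via toℕ x < toℕ y)
  eCol : Fin 3 → Fin n → ℕ
  eCol j v = sumF (λ x → count (λ y →
    (toℕ x <ᵇ toℕ y) ∧ inClosedNbhd v x ∧ inClosedNbhd v y ∧ isCol j x y))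

c1 c2 c3 : Fin 3
c1 = Fin.zero
c2 = Fin.suc Fin.zero
c3 = Fin.suc (Fin.suc Fin.zero)

IsFlipGraph : ∀ {n} → Graph n → ℕ → ℕ → ℕ → Set
IsFlipGraph {n} G a1 a2 a3 = Σ (Colouring G) λ c →
  (∀ v → degCol c c1 v ≡ a1 × degCol c c2 v ≡ a2 × degCol c c3 v ≡ a3)
  × (∀ v → eCol c c3 v < eCol c c2 v × eCol c c2 v < eCol c c1 v)

Is3FlipSequence : ℕ → ℕ → ℕ → Set
Is3FlipSequence a1 a2 a3 =
  (0 < a1 × a1 < a2 × a2 < a3) × ∃ λ n → Σ (Graph (suc n)) λ G → IsFlipGraph G a1 a2 a3

{-# OPTIONS --safe #-}
-- Double counting; colour 1 is called red. Summed over all vertices v, e_j[v] counts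
-- each colour-j edge xy once for v = x, once for v = y and once for every common
-- neighbour v of x and y, so 2 Σ_v e_j[v] = 2 n a_j + T_j, where T_j counts triangles
-- with a marked colour-j edge (twice). Summing e_2[v] + e_3[v] + 3 ≤ 2 e_1[v] gives
-- n (2 a_2 + 2 a_3 + 6) + T_2 + T_3 ≤ 4 n a_1 + 2 T_1. A triangle with k red edges
-- satisfies 2k ≤ (3 − k) + 3w, where w is the number of its corners at which both edges
-- are red; summing, 2 T_1 ≤ T_2 + T_3 + 3W, and W ≤ n a_1² since W counts pairs of red
-- edges at a common vertex (that are closed by an edge). Hence
-- 2 a_2 + 2 a_3 + 6 ≤ 4 a_1 + 3 a_1², and a_1 < a_2 yields a_3 < 2 a_1².
module Submission where

open import Defs
open import Data.Nat using (ℕ; zero; suc; _+_; _*_; _<_; _≤_; _≤?_; _<ᵇ_; z≤n; s≤s)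
open import Data.Nat.Properties hiding (_≟_)
open import Data.Nat.Tactic.RingSolver using (solve-∀)
open import Data.Bool using (Bool; true; false; if_then_else_; _∧_)
open import Data.Fin using (Fin; toℕ)
open import Data.Fin.Properties using (_≟_; toℕ-injective; all?)
open import Data.Product using (_×_; _,_; proj₁; proj₂)
open import Function using (_∘_)
open import Relation.Nullary using (Dec; yes; no; ofʸ; ofⁿ; contradiction)
open import Relation.Nullary.Decidable using (⌊_⌋; map′; _×-dec_; toWitness)
open import Relation.Binary.PropositionalEquality as ≡
  using (_≡_; refl; cong; cong₂; trans; subst₂; module ≡-Reasoning)
open import Algebra.Properties.Semiring.Sum +-*-semiring
  using (sum; sum-syntax; ∑-distrib-+; ∑-comm; *-distribˡ-sum; *-distribʳ-sum; sum-cong-≗)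

ind : Bool → ℕ
ind b = if b then 1 else 0

ind-∧ : ∀ a b → ind (a ∧ b) ≡ ind a * ind b
ind-∧ true  b = ≡.sym (+-identityʳ (ind b))
ind-∧ false b = refl

sumF≡sum : ∀ {m} (f : Fin m → ℕ) → sumF f ≡ sum f
sumF≡sum {zero}  f = refl
sumF≡sum {suc m} f = cong (f Fin.zero +_) (sumF≡sum (λ i → f (Fin.suc i)))

count≡sum : ∀ {m} (p : Fin m → Bool) → count p ≡ ∑[ i < m ] ind (p i)
count≡sum {zero}  p = refl
count≡sum {suc m} p = cong (ind (p Fin.zero) +_) (count≡sum (λ i → p (Fin.suc i)))

sum-const : ∀ m k → ∑[ i < m ] k ≡ m * k
sum-const zero    k = refl
sum-const (suc m) k = cong (k +_) (sum-const m k)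

sum-mono-≤ : ∀ {m} {f g : Fin m → ℕ} → (∀ i → f i ≤ g i) → sum f ≤ sum g
sum-mono-≤ {zero}  f≤g = z≤n
sum-mono-≤ {suc m} f≤g = +-mono-≤ (f≤g Fin.zero) (sum-mono-≤ (λ i → f≤g (Fin.suc i)))

sum-indicator : ∀ {m} (x : Fin m) (h : Fin m → ℕ) → ∑[ v < m ] (ind ⌊ x ≟ v ⌋ * h v) ≡ h x
sum-indicator {suc m} Fin.zero h =
  trans (cong (h Fin.zero + 0 +_) (trans (sum-const m 0) (*-zeroʳ m)))
        (trans (+-identityʳ _) (+-identityʳ _))
sum-indicator {suc m} (Fin.suc x) h =
  trans (sum-cong-≗ (λ v → cong (λ b → ind b * h (Fin.suc v)) (⌊suc≟suc⌋ x v)))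
        (sum-indicator x (λ v → h (Fin.suc v)))
  where
  ⌊suc≟suc⌋ : ∀ {m} (x y : Fin m) → ⌊ Fin.suc x ≟ Fin.suc y ⌋ ≡ ⌊ x ≟ y ⌋
  ⌊suc≟suc⌋ x y with x ≟ y
  ... | yes _ = refl
  ... | no _  = refl

sum-symmetric : ∀ {m} (g : Fin m → Fin m → ℕ) →
  (∀ x y → g x y ≡ g y x) → (∀ x → g x x ≡ 0) →
  ∑[ x < m ] ∑[ y < m ] g x y ≡ 2 * ∑[ x < m ] ∑[ y < m ] (ind (toℕ x <ᵇ toℕ y) * g x y)
sum-symmetric {m} g g-sym g-diag = begin
    ∑[ x < m ] ∑[ y < m ] g x y
  ≡⟨ sum-cong-≗ (λ x → sum-cong-≗ (split x)) ⟩
    ∑[ x < m ] ∑[ y < m ] (below x y + below y x)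
  ≡⟨ sum-cong-≗ (λ x → ∑-distrib-+ (below x) (λ y → below y x)) ⟩
    ∑[ x < m ] (∑[ y < m ] below x y + ∑[ y < m ] below y x)
  ≡⟨ ∑-distrib-+ (λ x → ∑[ y < m ] below x y) (λ x → ∑[ y < m ] below y x) ⟩
    S + ∑[ x < m ] ∑[ y < m ] below y x
  ≡⟨ cong (S +_) (∑-comm (λ x y → below y x)) ⟩
    S + S
  ≡⟨ cong (S +_) (≡.sym (+-identityʳ S)) ⟩
    2 * S ∎
  where
  open ≡-Reasoning
  below : Fin m → Fin m → ℕ
  below x y = ind (toℕ x <ᵇ toℕ y) * g x y
  S : ℕ
  S = ∑[ x < m ] ∑[ y < m ] below x y
  split : ∀ x y → g x y ≡ below x y + below y x
  split x y with toℕ x <ᵇ toℕ y | <ᵇ-reflects-< (toℕ x) (toℕ y)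
               | toℕ y <ᵇ toℕ x | <ᵇ-reflects-< (toℕ y) (toℕ x)
  ... | true  | ofʸ x<y | true  | ofʸ y<x = contradiction y<x (<-asym x<y)
  ... | true  | _       | false | _       = ≡.sym (trans (+-identityʳ _) (+-identityʳ _))
  ... | false | _       | true  | _       = trans (g-sym x y) (≡.sym (+-identityʳ _))
  ... | false | ofⁿ x≮y | false | ofⁿ y≮x
    rewrite toℕ-injective (≤-antisym (≮⇒≥ y≮x) (≮⇒≥ x≮y)) = g-diag y

module _ {m : ℕ} where

  private
    Fun³ : Set
    Fun³ = Fin m → Fin m → Fin m → ℕ

  ∑³ : Fun³ → ℕ
  ∑³ f = ∑[ x < m ] ∑[ y < m ] ∑[ z < m ] f x y z

  ∑³-cong : {f g : Fun³} → (∀ x y z → f x y z ≡ g x y z) → ∑³ f ≡ ∑³ g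
  ∑³-cong f≡g = sum-cong-≗ (λ x → sum-cong-≗ (λ y → sum-cong-≗ (f≡g x y)))

  ∑³-mono-≤ : {f g : Fun³} → (∀ x y z → f x y z ≤ g x y z) → ∑³ f ≤ ∑³ g
  ∑³-mono-≤ f≤g = sum-mono-≤ (λ x → sum-mono-≤ (λ y → sum-mono-≤ (f≤g x y)))

  ∑³-distrib-+ : (f g : Fun³) → ∑³ (λ x y z → f x y z + g x y z) ≡ ∑³ f + ∑³ g
  ∑³-distrib-+ f g =
    trans (sum-cong-≗ (λ x → trans (sum-cong-≗ (λ y → ∑-distrib-+ (f x y) (g x y)))
                                    (∑-distrib-+ (λ y → sum (f x y)) (λ y → sum (g x y)))))
          (∑-distrib-+ (λ x → ∑[ y < m ] sum (f x y)) (λ x → ∑[ y < m ] sum (g x y)))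

  *-distribˡ-∑³ : ∀ k (f : Fun³) → k * ∑³ f ≡ ∑³ (λ x y z → k * f x y z)
  *-distribˡ-∑³ k f =
    trans (*-distribˡ-sum k (λ x → ∑[ y < m ] sum (f x y)))
          (sum-cong-≗ (λ x → trans (*-distribˡ-sum k (λ y → sum (f x y)))
                                    (sum-cong-≗ (λ y → *-distribˡ-sum k (f x y)))))

  ∑³-rotate : (f : Fun³) → ∑³ (λ x y z → f y z x) ≡ ∑³ f
  ∑³-rotate f = trans (∑-comm (λ x y → ∑[ z < m ] f y z x))
                      (sum-cong-≗ (λ y → ∑-comm (λ x z → f y z x)))

  rotations : Fun³ → Fun³
  rotations f x y z = f x y z + f y z x + f z x y

  ∑³-rotations : (f : Fun³) → ∑³ (rotations f) ≡ 3 * ∑³ f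
  ∑³-rotations f = begin
      ∑³ (rotations f)
    ≡⟨ ∑³-distrib-+ (λ x y z → f x y z + f y z x) (λ x y z → f z x y) ⟩
      ∑³ (λ x y z → f x y z + f y z x) + ∑³ (λ x y z → f z x y)
    ≡⟨ cong₂ _+_ (trans (∑³-distrib-+ f (λ x y z → f y z x)) (cong (∑³ f +_) (∑³-rotate f)))
                 (trans (∑³-rotate (λ x y z → f y z x)) (∑³-rotate f)) ⟩
      ∑³ f + ∑³ f + ∑³ f
    ≡⟨ thrice (∑³ f) ⟩
      3 * ∑³ f ∎
    where
    open ≡-Reasoning
    thrice : ∀ s → s + s + s ≡ 3 * s
    thrice = solve-∀

all-Bool? : {P : Bool → Set} → (∀ b → Dec (P b)) → Dec (∀ b → P b)
all-Bool? {P} P? = map′ fromPair (λ h → h false , h true) (P? false ×-dec P? true)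
  where
  fromPair : P false × P true → ∀ b → P b
  fromPair (pf , pt) false = pf
  fromPair (pf , pt) true  = pt

edgeInd : Fin 3 → Bool → Fin 3 → ℕ
edgeInd j a p = ind (a ∧ ⌊ p ≟ j ⌋)

red other : Bool → Fin 3 → ℕ
red         = edgeInd c1
other a p   = edgeInd c2 a p + edgeInd c3 a p

-- (a , p), (b , q), (c , r): adjacency and colour of the pairs xy, yz, zx.
triangle-bound : ∀ a b c p q r →
  2 * (red a p * (ind c * ind b) + red b q * (ind a * ind c) + red c r * (ind b * ind a))
    ≤ (other a p * (ind c * ind b) + other b q * (ind a * ind c) + other c r * (ind b * ind a))
      + 3 * (ind a * (red c r * red b q) + ind b * (red a p * red c r) + ind c * (red b q * red a p))
triangle-bound = toWitness {a? = all-Bool? λ a → all-Bool? λ b → all-Bool? λ c →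
                                 all? λ p → all? λ q → all? λ r → _ ≤? _} _

c<b<a⇒b+c+3≤2a : ∀ {a b c} → c < b → b < a → b + c + 3 ≤ 2 * a
c<b<a⇒b+c+3≤2a {a} {b} {c} c<b b<a = begin
    b + c + 3
  ≡⟨ shift b c ⟩
    suc b + suc (suc c)
  ≤⟨ +-mono-≤ b<a (≤-trans (s≤s c<b) b<a) ⟩
    a + a
  ≡⟨ cong (a +_) (≡.sym (+-identityʳ a)) ⟩
    2 * a ∎
  where
  open ≤-Reasoning
  shift : ∀ b c → b + c + 3 ≡ suc b + suc (suc c)
  shift = solve-∀

module FlipCounting {n : ℕ} (G : Graph n) (c : Colouring G) where

  A : Fin n → Fin n → ℕ
  A x y = ind (adj G x y)

  χ : Fin 3 → Fin n → Fin n → ℕ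
  χ j x y = ind (isCol c j x y)

  ν : Fin n → Fin n → ℕ
  ν v x = ind (inClosedNbhd c v x)

  codegree : Fin n → Fin n → ℕ
  codegree x y = ∑[ z < n ] (A z x * A z y)

  isCol-sym : ∀ j x y → isCol c j x y ≡ isCol c j y x
  isCol-sym j x y rewrite Graph.sym G x y | colSym c x y = refl

  isCol⇒adj : ∀ j x y → isCol c j x y ≡ true → adj G x y ≡ true
  isCol⇒adj j x y eq with adj G x y
  ... | true  = refl
  ... | false = eq

  ν≡δ+A : ∀ v x → ν v x ≡ ind ⌊ x ≟ v ⌋ + A v x
  ν≡δ+A v x with x ≟ v
  ... | yes refl rewrite irrefl G x = refl
  ... | no _     = refl

  double-eCol : ∀ j v → 2 * eCol c j v ≡ ∑[ x < n ] ∑[ y < n ] (ν v x * (ν v y * χ j x y))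
  double-eCol j v = trans (cong (2 *_) eCol≡ordered) (≡.sym (sum-symmetric g g-sym g-diag))
    where
    g : Fin n → Fin n → ℕ
    g x y = ν v x * (ν v y * χ j x y)

    g-sym : ∀ x y → g x y ≡ g y x
    g-sym x y rewrite isCol-sym j x y = swap (ν v x) (ν v y) (χ j y x)
      where
      swap : ∀ a b e → a * (b * e) ≡ b * (a * e)
      swap = solve-∀

    g-diag : ∀ x → g x x ≡ 0
    g-diag x rewrite irrefl G x = trans (cong (ν v x *_) (*-zeroʳ (ν v x))) (*-zeroʳ (ν v x))

    edge : Fin n → Fin n → Bool
    edge x y = (toℕ x <ᵇ toℕ y) ∧ inClosedNbhd c v x ∧ inClosedNbhd c v y ∧ isCol c j x y

    ind-edge : ∀ x y → ind (edge x y) ≡ ind (toℕ x <ᵇ toℕ y) * g x y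
    ind-edge x y =
      trans (ind-∧ (toℕ x <ᵇ toℕ y) _) (cong (ind (toℕ x <ᵇ toℕ y) *_)
      (trans (ind-∧ (inClosedNbhd c v x) _) (cong (ν v x *_) (ind-∧ (inClosedNbhd c v y) _))))

    eCol≡ordered : eCol c j v ≡ ∑[ x < n ] ∑[ y < n ] (ind (toℕ x <ᵇ toℕ y) * g x y)
    eCol≡ordered = trans (sumF≡sum (λ x → count (edge x)))
                         (sum-cong-≗ (λ x → trans (count≡sum (edge x)) (sum-cong-≗ (ind-edge x))))

  closedNbhd-codegree : ∀ x y → adj G x y ≡ true → ∑[ v < n ] (ν v x * ν v y) ≡ 2 + codegree x y
  closedNbhd-codegree x y xy = begin
      ∑[ v < n ] (ν v x * ν v y)
    ≡⟨ sum-cong-≗ (λ v → trans (cong₂ _*_ (ν≡δ+A v x) (ν≡δ+A v y))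
                               (expand (δ x v) (A v x) (δ y v) (A v y))) ⟩
      ∑[ v < n ] (δ x v * (δ y v + A v y) + (A v x * δ y v + A v x * A v y))
    ≡⟨ ∑-distrib-+ (λ v → δ x v * (δ y v + A v y)) (λ v → A v x * δ y v + A v x * A v y) ⟩
      ∑[ v < n ] (δ x v * (δ y v + A v y)) + ∑[ v < n ] (A v x * δ y v + A v x * A v y)
    ≡⟨ cong₂ _+_ (sum-indicator x (λ v → δ y v + A v y))
                 (∑-distrib-+ (λ v → A v x * δ y v) (λ v → A v x * A v y)) ⟩
      (δ y x + A x y) + (∑[ v < n ] (A v x * δ y v) + codegree x y)
    ≡⟨ cong (λ s → (δ y x + A x y) + (s + codegree x y))
         (trans (sum-cong-≗ (λ v → *-comm (A v x) (δ y v))) (sum-indicator y (λ v → A v x))) ⟩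
      (δ y x + A x y) + (A y x + codegree x y)
    ≡⟨ cong₂ (λ s t → (s + A x y) + (t + codegree x y))
             δyx≡0 (cong ind (trans (Graph.sym G y x) xy)) ⟩
      A x y + (1 + codegree x y)
    ≡⟨ cong (λ s → s + (1 + codegree x y)) (cong ind xy) ⟩
      2 + codegree x y ∎
    where
    open ≡-Reasoning
    δ : Fin n → Fin n → ℕ
    δ x v = ind ⌊ x ≟ v ⌋
    expand : ∀ a b e f → (a + b) * (e + f) ≡ a * (e + f) + (b * e + b * f)
    expand = solve-∀
    δyx≡0 : δ y x ≡ 0
    δyx≡0 with y ≟ x
    ... | yes refl = contradiction (trans (≡.sym (irrefl G y)) xy) λ ()
    ... | no _     = refl

  sum-closedNbhd-edge : ∀ j x y →
    ∑[ v < n ] (ν v x * (ν v y * χ j x y)) ≡ χ j x y * (2 + codegree x y)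
  sum-closedNbhd-edge j x y = begin
      ∑[ v < n ] (ν v x * (ν v y * χ j x y))
    ≡⟨ sum-cong-≗ (λ v → rearrange (ν v x) (ν v y) (χ j x y)) ⟩
      ∑[ v < n ] (χ j x y * (ν v x * ν v y))
    ≡⟨ ≡.sym (*-distribˡ-sum (χ j x y) (λ v → ν v x * ν v y)) ⟩
      χ j x y * ∑[ v < n ] (ν v x * ν v y)
    ≡⟨ on-edges ⟩
      χ j x y * (2 + codegree x y) ∎
    where
    open ≡-Reasoning
    rearrange : ∀ a b e → a * (b * e) ≡ e * (a * b)
    rearrange = solve-∀
    on-edges : χ j x y * ∑[ v < n ] (ν v x * ν v y) ≡ χ j x y * (2 + codegree x y)
    on-edges with isCol c j x y in xy
    ... | false = refl
    ... | true  = cong (1 *_) (closedNbhd-codegree x y (isCol⇒adj j x y xy))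

  triangles : Fin 3 → ℕ
  triangles j = ∑³ (λ x y z → χ j x y * (A z x * A z y))

  sum-eCol : ∀ j a → (∀ x → degCol c j x ≡ a) →
    2 * ∑[ v < n ] eCol c j v ≡ n * (2 * a) + triangles j
  sum-eCol j a regular = begin
      2 * ∑[ v < n ] eCol c j v
    ≡⟨ *-distribˡ-sum 2 (eCol c j) ⟩
      ∑[ v < n ] (2 * eCol c j v)
    ≡⟨ sum-cong-≗ (double-eCol j) ⟩
      ∑[ v < n ] ∑[ x < n ] ∑[ y < n ] g v x y
    ≡⟨ ∑-comm (λ v x → ∑[ y < n ] g v x y) ⟩
      ∑[ x < n ] ∑[ v < n ] ∑[ y < n ] g v x y
    ≡⟨ sum-cong-≗ (λ x → ∑-comm (λ v y → g v x y)) ⟩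
      ∑[ x < n ] ∑[ y < n ] ∑[ v < n ] g v x y
    ≡⟨ sum-cong-≗ (λ x → trans (sum-cong-≗ (sum-closedNbhd-edge j x)) (row x)) ⟩
      ∑[ x < n ] (2 * a + T x)
    ≡⟨ ∑-distrib-+ (λ _ → 2 * a) T ⟩
      ∑[ x < n ] (2 * a) + triangles j
    ≡⟨ cong (_+ triangles j) (sum-const n (2 * a)) ⟩
      n * (2 * a) + triangles j ∎
    where
    open ≡-Reasoning
    g : Fin n → Fin n → Fin n → ℕ
    g v x y = ν v x * (ν v y * χ j x y)
    T : Fin n → ℕ
    T x = ∑[ y < n ] ∑[ z < n ] (χ j x y * (A z x * A z y))
    row : ∀ x → ∑[ y < n ] (χ j x y * (2 + codegree x y))
              ≡ 2 * a + T x
    row x = begin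
        ∑[ y < n ] (χ j x y * (2 + codegree x y))
      ≡⟨ sum-cong-≗ (λ y → *-distribˡ-+ (χ j x y) 2 (codegree x y)) ⟩
        ∑[ y < n ] (χ j x y * 2 + χ j x y * codegree x y)
      ≡⟨ ∑-distrib-+ (λ y → χ j x y * 2) (λ y → χ j x y * codegree x y) ⟩
        ∑[ y < n ] (χ j x y * 2) + ∑[ y < n ] (χ j x y * codegree x y)
      ≡⟨ cong₂ _+_ (≡.sym (*-distribʳ-sum 2 (χ j x)))
                   (sum-cong-≗ (λ y → *-distribˡ-sum (χ j x y) (λ z → A z x * A z y))) ⟩
        ∑[ y < n ] χ j x y * 2 + T x
      ≡⟨ cong (λ d → d * 2 + T x) (trans (≡.sym (count≡sum (isCol c j x))) (regular x)) ⟩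
        a * 2 + T x
      ≡⟨ cong (_+ T x) (*-comm a 2) ⟩
        2 * a + T x ∎

  private
    redTriangle otherTriangle redWedge : Fin n → Fin n → Fin n → ℕ
    redTriangle x y z   = χ c1 x y * (A z x * A z y)
    otherTriangle x y z = (χ c2 x y + χ c3 x y) * (A z x * A z y)
    redWedge x y z      = A x y * (χ c1 z x * χ c1 z y)

  redWedges : ℕ
  redWedges = ∑³ redWedge

  triangle-bound-at : ∀ x y z →
    2 * rotations redTriangle x y z ≤ rotations otherTriangle x y z + 3 * rotations redWedge x y z
  triangle-bound-at x y z
    rewrite Graph.sym G z y | Graph.sym G x z | Graph.sym G y x
          | colSym c z y | colSym c x z | colSym c y x
    = triangle-bound (adj G x y) (adj G y z) (adj G z x) (col c x y) (col c y z) (col c z x)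

  triangle-inequality : 2 * triangles c1 ≤ (triangles c2 + triangles c3) + 3 * redWedges
  triangle-inequality = *-cancelˡ-≤ 3 (begin
      3 * (2 * triangles c1)
    ≡⟨ swap (triangles c1) ⟩
      2 * (3 * ∑³ redTriangle)
    ≡⟨ cong (2 *_) (≡.sym (∑³-rotations redTriangle)) ⟩
      2 * ∑³ (rotations redTriangle)
    ≡⟨ *-distribˡ-∑³ 2 (rotations redTriangle) ⟩
      ∑³ (λ x y z → 2 * rotations redTriangle x y z)
    ≤⟨ ∑³-mono-≤ triangle-bound-at ⟩
      ∑³ (λ x y z → rotations otherTriangle x y z + 3 * rotations redWedge x y z)
    ≡⟨ ∑³-distrib-+ (rotations otherTriangle) (λ x y z → 3 * rotations redWedge x y z) ⟩
      ∑³ (rotations otherTriangle) + ∑³ (λ x y z → 3 * rotations redWedge x y z)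
    ≡⟨ cong₂ _+_ (trans (∑³-rotations otherTriangle) (cong (3 *_) otherTriangles))
                 (trans (≡.sym (*-distribˡ-∑³ 3 (rotations redWedge)))
                        (cong (3 *_) (∑³-rotations redWedge))) ⟩
      3 * (triangles c2 + triangles c3) + 3 * (3 * redWedges)
    ≡⟨ ≡.sym (*-distribˡ-+ 3 (triangles c2 + triangles c3) (3 * redWedges)) ⟩
      3 * ((triangles c2 + triangles c3) + 3 * redWedges) ∎)
    where
    open ≤-Reasoning
    swap : ∀ s → 3 * (2 * s) ≡ 2 * (3 * s)
    swap = solve-∀
    otherTriangles : ∑³ otherTriangle ≡ triangles c2 + triangles c3
    otherTriangles = trans (∑³-cong (λ x y z → *-distribʳ-+ (A z x * A z y) (χ c2 x y) (χ c3 x y)))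
                           (∑³-distrib-+ (λ x y z → χ c2 x y * (A z x * A z y))
                                         (λ x y z → χ c3 x y * (A z x * A z y)))

  redWedges≤ : ∀ a → (∀ x → degCol c c1 x ≡ a) → redWedges ≤ n * (a * a)
  redWedges≤ a regular = begin
      redWedges
    ≤⟨ ∑³-mono-≤ (λ x y z → ind*≤ (adj G x y) (χ c1 z x * χ c1 z y)) ⟩
      ∑³ (λ x y z → χ c1 z x * χ c1 z y)
    ≡⟨ trans (∑³-rotate (λ x y z → wedge y z x)) (∑³-rotate wedge) ⟩
      ∑[ z < n ] ∑[ x < n ] ∑[ y < n ] (χ c1 z x * χ c1 z y)
    ≡⟨ sum-cong-≗ (λ z →
         trans (sum-cong-≗ (λ x → ≡.sym (*-distribˡ-sum (χ c1 z x) (χ c1 z))))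
               (≡.sym (*-distribʳ-sum (sum (χ c1 z)) (χ c1 z)))) ⟩
      ∑[ z < n ] (sum (χ c1 z) * sum (χ c1 z))
    ≡⟨ sum-cong-≗ (λ z → cong₂ _*_ (degree z) (degree z)) ⟩
      ∑[ z < n ] (a * a)
    ≡⟨ sum-const n (a * a) ⟩
      n * (a * a) ∎
    where
    open ≤-Reasoning
    wedge : Fin n → Fin n → Fin n → ℕ
    wedge z x y = χ c1 z x * χ c1 z y
    ind*≤ : ∀ b k → ind b * k ≤ k
    ind*≤ true  k = ≤-reflexive (*-identityˡ k)
    ind*≤ false k = z≤n
    degree : ∀ z → sum (χ c1 z) ≡ a
    degree z = trans (≡.sym (count≡sum (isCol c c1 z))) (regular z)

  sum-nested : (∀ v → eCol c c3 v < eCol c c2 v × eCol c c2 v < eCol c c1 v) →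
    ∑[ v < n ] eCol c c2 v + ∑[ v < n ] eCol c c3 v + n * 3 ≤ 2 * ∑[ v < n ] eCol c c1 v
  sum-nested nested = subst₂ _≤_
    (trans (∑-distrib-+ (λ v → eCol c c2 v + eCol c c3 v) (λ _ → 3))
           (cong₂ _+_ (∑-distrib-+ (eCol c c2) (eCol c c3)) (sum-const n 3)))
    (≡.sym (*-distribˡ-sum 2 (eCol c c1)))
    (sum-mono-≤ (λ v → c<b<a⇒b+c+3≤2a (proj₁ (nested v)) (proj₂ (nested v))))

  flip-bound : ∀ {a1 a2 a3} →
    (∀ v → degCol c c1 v ≡ a1 × degCol c c2 v ≡ a2 × degCol c c3 v ≡ a3) →
    (∀ v → eCol c c3 v < eCol c c2 v × eCol c c2 v < eCol c c1 v) →
    n * (2 * a2 + 2 * a3 + 6) ≤ n * (4 * a1 + 3 * (a1 * a1))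
  flip-bound {a1} {a2} {a3} degrees nested = +-cancelʳ-≤ (P c2 + P c3) _ _ (begin
      n * (2 * a2 + 2 * a3 + 6) + (P c2 + P c3)
    ≡⟨ regroup n a2 a3 (P c2) (P c3) ⟩
      (n * (2 * a2) + P c2) + (n * (2 * a3) + P c3) + 2 * (n * 3)
    ≡⟨ cong₂ (λ s t → s + t + 2 * (n * 3))
             (≡.sym (sum-eCol c2 a2 (proj₁ ∘ proj₂ ∘ degrees)))
             (≡.sym (sum-eCol c3 a3 (proj₂ ∘ proj₂ ∘ degrees))) ⟩
      2 * E c2 + 2 * E c3 + 2 * (n * 3)
    ≡⟨ factor (E c2) (E c3) (n * 3) ⟩
      2 * (E c2 + E c3 + n * 3)
    ≤⟨ *-monoʳ-≤ 2 (sum-nested nested) ⟩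
      2 * (2 * E c1)
    ≡⟨ cong (2 *_) (sum-eCol c1 a1 (proj₁ ∘ degrees)) ⟩
      2 * (n * (2 * a1) + P c1)
    ≡⟨ double n a1 (P c1) ⟩
      n * (4 * a1) + 2 * P c1
    ≤⟨ +-monoʳ-≤ (n * (4 * a1)) triangle-inequality ⟩
      n * (4 * a1) + ((P c2 + P c3) + 3 * redWedges)
    ≤⟨ +-monoʳ-≤ (n * (4 * a1))
         (+-monoʳ-≤ (P c2 + P c3) (*-monoʳ-≤ 3 (redWedges≤ a1 (proj₁ ∘ degrees)))) ⟩
      n * (4 * a1) + ((P c2 + P c3) + 3 * (n * (a1 * a1)))
    ≡⟨ collect n a1 (P c2 + P c3) ⟩
      n * (4 * a1 + 3 * (a1 * a1)) + (P c2 + P c3) ∎)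
    where
    open ≤-Reasoning
    P : Fin 3 → ℕ
    P = triangles
    E : Fin 3 → ℕ
    E j = ∑[ v < n ] eCol c j v
    regroup : ∀ n a2 a3 p q → n * (2 * a2 + 2 * a3 + 6) + (p + q)
                              ≡ (n * (2 * a2) + p) + (n * (2 * a3) + q) + 2 * (n * 3)
    regroup = solve-∀
    factor : ∀ s t u → 2 * s + 2 * t + 2 * u ≡ 2 * (s + t + u)
    factor = solve-∀
    double : ∀ n a p → 2 * (n * (2 * a) + p) ≡ n * (4 * a) + 2 * p
    double = solve-∀
    collect : ∀ n a p → n * (4 * a) + (p + 3 * (n * (a * a))) ≡ n * (4 * a + 3 * (a * a)) + p
    collect = solve-∀

flipGraph-bound : ∀ {n a1 a2 a3} (G : Graph (suc n)) → IsFlipGraph G a1 a2 a3 →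
  2 * a2 + 2 * a3 + 6 ≤ 4 * a1 + 3 * (a1 * a1)
flipGraph-bound {n} G (c , degrees , nested) =
  *-cancelˡ-≤ (suc n) (FlipCounting.flip-bound G c degrees nested)

double≤square+1 : ∀ k → 2 * k ≤ k * k + 1
double≤square+1 zero          = z≤n
double≤square+1 (suc zero)    = ≤-refl
double≤square+1 (suc (suc j)) = begin
    2 * (2 + j)
  ≤⟨ m≤m+n (2 * (2 + j)) (j * j + 2 * j + 1) ⟩
    2 * (2 + j) + (j * j + 2 * j + 1)
  ≡⟨ expand j ⟩
    (2 + j) * (2 + j) + 1 ∎
  where
  open ≤-Reasoning
  expand : ∀ j → 2 * (2 + j) + (j * j + 2 * j + 1) ≡ (2 + j) * (2 + j) + 1
  expand = solve-∀

flip-arithmetic : ∀ {a1 a2 a3} → a1 < a2 → 2 * a2 + 2 * a3 + 6 ≤ 4 * a1 + 3 * (a1 * a1) →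
  a3 < 2 * (a1 * a1)
flip-arithmetic {a1} {a2} {a3} a1<a2 bound = *-cancelˡ-≤ 2 (+-cancelʳ-≤ (2 * a1 + 1) _ _ (begin
    2 * suc a3 + (2 * a1 + 1)
  ≤⟨ m≤m+n _ 5 ⟩
    2 * suc a3 + (2 * a1 + 1) + 5
  ≡⟨ lhs-form a1 a3 ⟩
    2 * suc a1 + 2 * a3 + 6
  ≤⟨ +-monoˡ-≤ 6 (+-monoˡ-≤ (2 * a3) (*-monoʳ-≤ 2 a1<a2)) ⟩
    2 * a2 + 2 * a3 + 6
  ≤⟨ bound ⟩
    4 * a1 + 3 * (a1 * a1)
  ≡⟨ split-4a1 a1 ⟩
    2 * a1 + 3 * (a1 * a1) + 2 * a1
  ≤⟨ +-monoʳ-≤ (2 * a1 + 3 * (a1 * a1)) (double≤square+1 a1) ⟩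
    2 * a1 + 3 * (a1 * a1) + (a1 * a1 + 1)
  ≡⟨ rhs-form a1 ⟩
    2 * (2 * (a1 * a1)) + (2 * a1 + 1) ∎))
  where
  open ≤-Reasoning
  lhs-form : ∀ a1 a3 → 2 * suc a3 + (2 * a1 + 1) + 5 ≡ 2 * suc a1 + 2 * a3 + 6
  lhs-form = solve-∀
  split-4a1 : ∀ a1 → 4 * a1 + 3 * (a1 * a1) ≡ 2 * a1 + 3 * (a1 * a1) + 2 * a1
  split-4a1 = solve-∀
  rhs-form : ∀ a1 → 2 * a1 + 3 * (a1 * a1) + (a1 * a1 + 1) ≡ 2 * (2 * (a1 * a1)) + (2 * a1 + 1)
  rhs-form = solve-∀

theorem4p1 : (a1 a2 a3 : ℕ) → Is3FlipSequence a1 a2 a3 → a3 < 2 * (a1 * a1)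
theorem4p1 a1 a2 a3 ((_ , a1<a2 , _) , _ , G , flip) = flip-arithmetic a1<a2 (flipGraph-bound G flip)
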